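{- Let $G$ be a mixed graph on a finite vertex set with $n \geq 2$ vertices, with $E_1$ its set of non-edges, $E_2$ its set of non-oriented edges, $E_3$ its set of oriented edges, and $\overline{E_3}$ the set $E_3$ with all orientations reversed. Let $A \subseteq E_1 \cup E_2$ and $D \subseteq \overline{E_3}$, and let $N$ be the number of permutations $\mathbf{x}$ of $G$ with $A \cup D \subseteq E(\mathbf{x})$. Then $N$ is even, except when $|A|+|D| = n-1$, $|D|\geq 1$, and $A\cup D = E(\mathbf{x})$ for some permutation $\mathbf{x}$ of $G$, in which case $N=1$.
   Context: A mixed graph $G$ on a finite vertex set $V$: each unordered pair of distinct vertices is exactly one of: a non-edge (the set of these is $E_1$), a non-oriented edge (the set of these is $E_2$), or an oriented edge in one of the two possible directions (the set of these ordered pairs is $E_3$). $\overline{E_3}=\{(y,x) : (x,y)\in E_3\}$. A permutation of $G$ is an ordering $\mathbf{x}=(x_1,\dots,x_n)$ of all vertices of $G$. For $1\le i\le n-1$, the neighboring pair of $x_i,x_{i+1}$ is the unordered pair $\{x_i,x_{i+1}\}$ if this pair lies in $E_1\cup E_2$, and otherwise it is the ordered pair $(x_i,x_{i+1})$, which then lies in $E_3$ or in $\overline{E_3}$. $E(\mathbf{x})$ denotes the set of the $n-1$ neighboring pairs of $\mathbf{x}$. -}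

module Defs where

open import Data.Nat using (ℕ; zero; suc; _+_; _∸_; _≤_)
open import Data.Bool using (Bool; true; false; _∧_; _∨_; not; T)
open import Data.Fin using (Fin; _<?_)
open import Data.Fin.Properties using (_≟_)
open import Data.Vec using (Vec; []; _∷_)
open import Data.List using (List; []; _∷_; length; filterᵇ; allFin; concatMap; map; cartesianProduct)
open import Data.Bool.ListAction using (all; any)
open import Data.Product using (_×_; _,_; Σ)
open import Data.Sum using (_⊎_)
open import Relation.Binary.PropositionalEquality using (_≡_; _≢_)
open import Relation.Nullary.Decidable using (⌊_⌋)

-- Kind of the (ordered view of the) pair (x , y) in a mixed graph:
--   nonEdge    : {x,y} ∈ E₁
--   undirected : {x,y} ∈ E₂
--   forward    : (x,y) ∈ E₃
--   backward   : (y,x) ∈ E₃, i.e. (x,y) ∈ \overline{E₃}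
data Kind : Set where
  nonEdge undirected forward backward : Kind

rev : Kind → Kind
rev nonEdge    = nonEdge
rev undirected = undirected
rev forward    = backward
rev backward   = forward

-- Each unordered pair of distinct
-- vertices is exactly one of: non-edge, non-oriented edge, oriented edge
-- (in one of two directions); consistency is the symmetry condition.
-- (The value on the diagonal is irrelevant.)
record MixedGraph (n : ℕ) : Set where
  field
    kind     : Fin n → Fin n → Kind
    kind-sym : ∀ x y → x ≢ y → kind y x ≡ rev (kind x y)
open MixedGraph public

isE₁₂ : Kind → Bool
isE₁₂ nonEdge    = true
isE₁₂ undirected = true
isE₁₂ forward    = false
isE₁₂ backward   = false

isBack : Kind → Bool
isBack backward = true
isBack _        = false

-- A set A of unordered pairs of distinct vertices, given by its symmetric,
-- irreflexive indicator, with A ⊆ E₁ ∪ E₂.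
record ValidA {n : ℕ} (G : MixedGraph n) (A : Fin n → Fin n → Bool) : Set where
  field
    A-irrefl : ∀ x → A x x ≡ false
    A-sym    : ∀ x y → A x y ≡ A y x
    A-sub    : ∀ x y → T (A x y) → T (isE₁₂ (kind G x y))

record ValidD {n : ℕ} (G : MixedGraph n) (D : Fin n → Fin n → Bool) : Set where
  field
    D-sub : ∀ x y → T (D x y) → x ≢ y × T (isBack (kind G x y))

allPairs : (n : ℕ) → List (Fin n × Fin n)
allPairs n = cartesianProduct (allFin n) (allFin n)

cardA : {n : ℕ} → (Fin n → Fin n → Bool) → ℕ
cardA {n} A = length (filterᵇ (λ { (x , y) → ⌊ x <? y ⌋ ∧ A x y }) (allPairs n))

cardD : {n : ℕ} → (Fin n → Fin n → Bool) → ℕ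
cardD {n} D = length (filterᵇ (λ { (x , y) → D x y }) (allPairs n))

vecs : (n k : ℕ) → List (Vec (Fin n) k)
vecs n zero    = [] ∷ []
vecs n (suc k) = concatMap (λ x → map (x ∷_) (vecs n k)) (allFin n)

notIn : {n k : ℕ} → Fin n → Vec (Fin n) k → Bool
notIn x []       = true
notIn x (y ∷ ys) = not ⌊ x ≟ y ⌋ ∧ notIn x ys

distinct : {n k : ℕ} → Vec (Fin n) k → Bool
distinct []       = true
distinct (x ∷ xs) = notIn x xs ∧ distinct xs

-- a permutation of G: an ordering (x₁,…,xₙ) of all vertices
IsPerm : {n : ℕ} → Vec (Fin n) n → Bool
IsPerm = distinct

consec : {n k : ℕ} → Vec (Fin n) k → List (Fin n × Fin n)
consec []               = []
consec (x ∷ [])         = []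
consec (x ∷ y ∷ xs)     = (x , y) ∷ consec (y ∷ xs)

eqF : {n : ℕ} → Fin n → Fin n → Bool
eqF x y = ⌊ x ≟ y ⌋

-- A ∪ D ⊆ E(x):
--   each unordered {a,b} ∈ A is a neighbouring pair (a,b adjacent in either order;
--   since {a,b} ∈ E₁ ∪ E₂ the neighbouring pair is unordered);
--   each ordered (a,b) ∈ D is the neighbouring pair (xᵢ,xᵢ₊₁) = (a,b).
Covers : {n : ℕ} → (A D : Fin n → Fin n → Bool) → Vec (Fin n) n → Bool
Covers {n} A D v =
  all (λ { (a , b) → not (A a b) ∨
           any (λ { (u , w) → (eqF u a ∧ eqF w b) ∨ (eqF u b ∧ eqF w a) }) (consec v) })
      (allPairs n)
  ∧
  all (λ { (a , b) → not (D a b) ∨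
           any (λ { (u , w) → eqF u a ∧ eqF w b }) (consec v) })
      (allPairs n)

-- For consecutive (u,w): if {u,w} ∈ E₁ ∪ E₂ the neighbouring pair is {u,w},
-- which must be in A; otherwise it is the ordered pair (u,w), which is in
-- \overline{E₃} iff kind u w = backward, and then must lie in D; if (u,w) ∈ E₃
-- it cannot lie in A ∪ D (A ⊆ E₁ ∪ E₂, D ⊆ \overline{E₃}).
Within : {n : ℕ} → MixedGraph n → (A D : Fin n → Fin n → Bool) → Vec (Fin n) n → Bool
Within G A D v =
  all (λ { (u , w) → (isE₁₂ (kind G u w) ∧ A u w) ∨ (isBack (kind G u w) ∧ D u w) }) (consec v)

countN : {n : ℕ} → (A D : Fin n → Fin n → Bool) → ℕ
countN {n} A D = length (filterᵇ (λ v → IsPerm v ∧ Covers A D v) (vecs n n))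

Exceptional : {n : ℕ} → MixedGraph n → (A D : Fin n → Fin n → Bool) → Set
Exceptional {n} G A D =
  (cardA A + cardD D ≡ n ∸ 1) × (1 ≤ cardD D) ×
  Σ (Vec (Fin n) n) (λ v → T (IsPerm v) × T (Covers A D v) × T (Within G A D v))

module Submission where

-- Call a pair required if it lies in A ∪ D. Cut a counted permutation x
-- into maximal blocks whose neighbouring pairs are all required. A required pair, in either order,
-- never straddles a block boundary, so if there are at least two blocks, exchanging the first two
-- gives a counted permutation with the same blocks, and this exchange is a fixed-point-free
-- involution. If x is a single block then E(x) ⊆ A ∪ D, and counting E(x) gives |A| + |D| = n - 1.
-- When D = ∅, reversal pairs x up instead. When D ≠ ∅ we are in the exceptional case: every counted
-- permutation contains all edges of the path x, hence is x or its reverse, and the reverse runs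
-- through a pair of D backwards; so x is the only one.

open import Defs
open import Data.Nat using (ℕ; zero; suc; _+_; _∸_; _≤_; _≤?_; s≤s; z≤n)
open import Data.Nat.Properties using (suc-injective; ≤-refl; ≤-trans; n≤1+n)
open import Data.Nat.Divisibility using (_∣_; divides; ∣-refl; ∣m∣n⇒∣m+n)
open import Data.Bool using (Bool; true; false; _∧_; _∨_; not; T; T?; if_then_else_)
open import Data.Bool.Properties using (T-∧; T-∨)
open import Data.Bool.ListAction using (all; any)
open import Data.Fin using (Fin; _<_; _<?_)
open import Data.Fin.Properties using (_≟_; <-asym; <-cmp)
open import Data.Vec using (Vec; []; _∷_; toList; fromList; cast)
import Data.Vec.Properties as Vecₚ
open import Data.Vec.Properties using (cast-is-id; toList-injective; toList-cast; toList∘fromList; length-toList)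
open import Data.List using (List; []; _∷_; _++_; [_]; length; reverse; _ʳ++_; map; filterᵇ)
open import Data.List.Properties
  using (++-identityʳ; ++-ʳ++; ʳ++-defn; reverse-involutive; reverse-++; length-++; length-map; length-reverse;
         ∷-injectiveˡ)
open import Data.List.Relation.Unary.Any using (here; there)
import Data.List.Relation.Unary.Any as Any
open import Data.List.Relation.Unary.Any.Properties using (any⁺; any⁻)
open import Data.List.Relation.Unary.All using (All; []; _∷_)
import Data.List.Relation.Unary.All as All
open import Data.List.Relation.Unary.All.Properties using (all⁺; all⁻)
import Data.List.Relation.Unary.All.Properties as Allₚ
import Data.List.Relation.Unary.AllPairs as AllPairs
import Data.List.Relation.Unary.AllPairs.Properties as AllPairsₚ
open import Data.List.Relation.Unary.Unique.Propositional using (Unique; []; _∷_)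
import Data.List.Relation.Unary.Unique.Propositional.Properties as Uniqueₚ
open import Data.List.Relation.Unary.Unique.Propositional.Properties using (Unique[x∷xs]⇒x∉xs; drop⁺)
open import Data.List.Relation.Binary.Disjoint.Propositional using (Disjoint)
open import Data.List.Membership.Propositional using (_∈_; _∉_; find)
open import Data.List.Membership.Propositional.Properties
  using (∈-++⁺ˡ; ∈-++⁺ʳ; ∈-++⁻; ∈-∃++; ∈-map⁺; ∈-map⁻; ∈-filter⁺; ∈-filter⁻; ∈-allFin; ∈-cartesianProduct⁺;
         ∈-concatMap⁺)
open import Data.List.Membership.Propositional.Properties.WithK using (unique∧set⇒bag)
open import Data.List.Relation.Binary.BagAndSetEquality using (∼bag⇒↭)
open import Data.List.Relation.Binary.Permutation.Propositional using (_↭_; ↭⇒↭ₛ; ↭-sym)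
open import Data.List.Relation.Binary.Permutation.Propositional.Properties
  using (↭-length; shift; shifts; ∈-resp-↭; ↭-reverse)
import Data.List.Relation.Binary.Permutation.Setoid.Properties as Permutationₛ
open import Data.Product using (_×_; _,_; proj₁; proj₂; ∃; ∃₂; swap; map₁)
open import Data.Sum using (_⊎_; inj₁; inj₂)
import Data.Sum as Sum
open import Data.Empty using (⊥; ⊥-elim)
open import Function using (_∘_; _⇔_; mk⇔; Equivalence)
open Equivalence using (to; from)
open import Relation.Nullary using (¬_; yes; no)
open import Relation.Nullary.Decidable using (⌊_⌋; toWitness; fromWitness)
open import Relation.Binary.Definitions using (Decidable; tri<; tri≈; tri>)
open import Relation.Binary.PropositionalEquality
  using (_≡_; _≢_; refl; sym; trans; cong; cong₂; subst; setoid; module ≡-Reasoning)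

module _ {X : Set} where

  consecutive : List X → List (X × X)
  consecutive (x ∷ y ∷ xs) = (x , y) ∷ consecutive (y ∷ xs)
  consecutive _            = []

  length-consecutive : ∀ (xs : List X) → length (consecutive xs) ≡ length xs ∸ 1
  length-consecutive []           = refl
  length-consecutive (x ∷ [])     = refl
  length-consecutive (x ∷ y ∷ xs) = cong suc (length-consecutive (y ∷ xs))

  junction : List X → List X → List (X × X)
  junction (x ∷ [])     (y ∷ _) = [ (x , y) ]
  junction (_ ∷ x ∷ xs) ys      = junction (x ∷ xs) ys
  junction _            _       = []

  consecutive-++ : ∀ xs ys → consecutive (xs ++ ys) ≡ consecutive xs ++ junction xs ys ++ consecutive ys
  consecutive-++ []           ys       = refl
  consecutive-++ (x ∷ [])     []       = refl
  consecutive-++ (x ∷ [])     (y ∷ ys) = refl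
  consecutive-++ (x ∷ y ∷ xs) ys       = cong ((x , y) ∷_) (consecutive-++ (y ∷ xs) ys)

  module _ {p : X × X} where

    ∈-consecutive-++⁻ : ∀ xs ys → p ∈ consecutive (xs ++ ys) →
                        p ∈ consecutive xs ⊎ p ∈ junction xs ys ⊎ p ∈ consecutive ys
    ∈-consecutive-++⁻ xs ys p∈ =
      Sum.map₂ (∈-++⁻ (junction xs ys)) (∈-++⁻ (consecutive xs) (subst (p ∈_) (consecutive-++ xs ys) p∈))

    ∈-consecutive-++⁺ˡ : ∀ xs ys → p ∈ consecutive xs → p ∈ consecutive (xs ++ ys)
    ∈-consecutive-++⁺ˡ xs ys p∈ = subst (p ∈_) (sym (consecutive-++ xs ys)) (∈-++⁺ˡ p∈)

    ∈-consecutive-++⁺ʳ : ∀ xs ys → p ∈ consecutive ys → p ∈ consecutive (xs ++ ys)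
    ∈-consecutive-++⁺ʳ xs ys p∈ =
      subst (p ∈_) (sym (consecutive-++ xs ys)) (∈-++⁺ʳ (consecutive xs) (∈-++⁺ʳ (junction xs ys) p∈))

  ∈-consecutive-∷ : ∀ {x a b : X} q → (a , b) ∈ consecutive q → (a , b) ∈ consecutive (x ∷ q)
  ∈-consecutive-∷ (c ∷ q) ab∈ = there ab∈

  ∈-consecutive-∷⁻ : ∀ {x a b : X} q → (a , b) ∈ consecutive (x ∷ q) → a ≡ x ⊎ (a , b) ∈ consecutive q
  ∈-consecutive-∷⁻ (c ∷ q) (here refl) = inj₁ refl
  ∈-consecutive-∷⁻ (c ∷ q) (there ab∈) = inj₂ ab∈

  module _ {u w : X} where

    ∈-consecutive⇒∈ : ∀ xs → (u , w) ∈ consecutive xs → u ∈ xs × w ∈ xs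
    ∈-consecutive⇒∈ (x ∷ y ∷ xs) (here refl) = here refl , there (here refl)
    ∈-consecutive⇒∈ (x ∷ y ∷ xs) (there uw∈) with u∈ , w∈ ← ∈-consecutive⇒∈ (y ∷ xs) uw∈ = there u∈ , there w∈

    ∈-junction⇒∈ : ∀ xs ys → (u , w) ∈ junction xs ys → u ∈ xs × w ∈ ys
    ∈-junction⇒∈ (x ∷ [])     (y ∷ ys) (here refl) = here refl , here refl
    ∈-junction⇒∈ (x ∷ x′ ∷ xs) ys      uw∈ with u∈ , w∈ ← ∈-junction⇒∈ (x′ ∷ xs) ys uw∈ = there u∈ , w∈

    ∈-junction⇒head : ∀ xs y ys → (u , w) ∈ junction xs (y ∷ ys) → w ≡ y
    ∈-junction⇒head (x ∷ [])      y ys (here refl) = refl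
    ∈-junction⇒head (x ∷ x′ ∷ xs) y ys uw∈        = ∈-junction⇒head (x′ ∷ xs) y ys uw∈

    ∈-consecutive⇒infix : ∀ xs → (u , w) ∈ consecutive xs → ∃₂ λ ys zs → xs ≡ ys ++ u ∷ w ∷ zs
    ∈-consecutive⇒infix (x ∷ y ∷ xs) (here refl) = [] , xs , refl
    ∈-consecutive⇒infix (x ∷ y ∷ xs) (there uw∈) with ys , zs , eq ← ∈-consecutive⇒infix (y ∷ xs) uw∈ =
      x ∷ ys , zs , cong (x ∷_) eq

    infix⇒∈-consecutive : ∀ ys zs → (u , w) ∈ consecutive (ys ++ u ∷ w ∷ zs)
    infix⇒∈-consecutive ys zs = ∈-consecutive-++⁺ʳ ys (u ∷ w ∷ zs) (here refl)

  ∈-consecutive-remove : ∀ q₁ q₂ {x a b : X} → a ≢ x → b ≢ x →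
                         (a , b) ∈ consecutive (q₁ ++ x ∷ q₂) → (a , b) ∈ consecutive (q₁ ++ q₂)
  ∈-consecutive-remove q₁ q₂ {x} a≢x b≢x ab∈ with ∈-consecutive-++⁻ q₁ (x ∷ q₂) ab∈
  ... | inj₁ ab∈q₁                 = ∈-consecutive-++⁺ˡ q₁ q₂ ab∈q₁
  ... | inj₂ (inj₁ ab∈junction)    = ⊥-elim (b≢x (∈-junction⇒head q₁ x q₂ ab∈junction))
  ... | inj₂ (inj₂ ab∈xq₂) with ∈-consecutive-∷⁻ q₂ ab∈xq₂
  ...   | inj₁ a≡x  = ⊥-elim (a≢x a≡x)
  ...   | inj₂ ab∈q₂ = ∈-consecutive-++⁺ʳ q₁ q₂ ab∈q₂

  reverse-infix : ∀ ys (u w : X) zs → reverse (ys ++ u ∷ w ∷ zs) ≡ reverse zs ++ w ∷ u ∷ reverse ys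
  reverse-infix ys u w zs = begin
    (ys ++ u ∷ w ∷ zs) ʳ++ []   ≡⟨ ++-ʳ++ ys ⟩
    zs ʳ++ w ∷ u ∷ reverse ys   ≡⟨ ʳ++-defn zs ⟩
    reverse zs ++ w ∷ u ∷ reverse ys ∎
    where open ≡-Reasoning

  reverse-++-∷ : ∀ xs (y : X) ys → reverse (xs ++ y ∷ ys) ≡ reverse ys ++ y ∷ reverse xs
  reverse-++-∷ xs y ys = begin
    (xs ++ y ∷ ys) ʳ++ []   ≡⟨ ++-ʳ++ xs ⟩
    ys ʳ++ y ∷ reverse xs   ≡⟨ ʳ++-defn ys ⟩
    reverse ys ++ y ∷ reverse xs ∎
    where open ≡-Reasoning

  ∈-consecutive-reverse : ∀ {u w} xs → (u , w) ∈ consecutive xs → (w , u) ∈ consecutive (reverse xs)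
  ∈-consecutive-reverse {u} {w} xs uw∈ with ys , zs , refl ← ∈-consecutive⇒infix xs uw∈ =
    subst (λ l → (w , u) ∈ consecutive l) (sym (reverse-infix ys u w zs))
          (infix⇒∈-consecutive (reverse zs) (reverse ys))

  ∈-consecutive-reverse⁻ : ∀ {u w} xs → (u , w) ∈ consecutive (reverse xs) → (w , u) ∈ consecutive xs
  ∈-consecutive-reverse⁻ {u} {w} xs uw∈ =
    subst (λ l → (w , u) ∈ consecutive l) (reverse-involutive xs) (∈-consecutive-reverse (reverse xs) uw∈)

  Adjacent : List X → X → X → Set
  Adjacent xs a b = (a , b) ∈ consecutive xs ⊎ (b , a) ∈ consecutive xs

  Adjacent-sym : ∀ {xs : List X} {a b} → Adjacent xs a b → Adjacent xs b a
  Adjacent-sym = Sum.swap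

  Adjacent-reverse : ∀ xs {a b} → Adjacent xs a b → Adjacent (reverse xs) a b
  Adjacent-reverse xs (inj₁ ab∈) = inj₂ (∈-consecutive-reverse xs ab∈)
  Adjacent-reverse xs (inj₂ ba∈) = inj₁ (∈-consecutive-reverse xs ba∈)

  Adjacent⇒∈ : ∀ {xs : List X} {a b} → Adjacent xs a b → a ∈ xs
  Adjacent⇒∈ {xs} (inj₁ ab∈) = proj₁ (∈-consecutive⇒∈ xs ab∈)
  Adjacent⇒∈ {xs} (inj₂ ba∈) = proj₂ (∈-consecutive⇒∈ xs ba∈)

module _ {X : Set} where

  ∈⇒1≤length : ∀ {x : X} {xs} → x ∈ xs → 1 ≤ length xs
  ∈⇒1≤length {xs = _ ∷ _} _ = s≤s z≤n

  1≤length⇒∈ : ∀ {xs : List X} → 1 ≤ length xs → ∃ (_∈ xs)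
  1≤length⇒∈ {x ∷ _} _ = x , here refl

  Unique-resp-↭ : ∀ {xs ys : List X} → xs ↭ ys → Unique xs → Unique ys
  Unique-resp-↭ p = Permutationₛ.Unique-resp-↭ (setoid X) (↭⇒↭ₛ p)

  Unique-++⇒disjoint : ∀ (xs : List X) {ys z} → Unique (xs ++ ys) → z ∈ xs → z ∉ ys
  Unique-++⇒disjoint (x ∷ xs) (x∉ ∷ _) (here refl) z∈ = All.lookup x∉ (∈-++⁺ʳ xs z∈) refl
  Unique-++⇒disjoint (x ∷ xs) (_ ∷ u)  (there z∈)  = Unique-++⇒disjoint xs u z∈

  Unique-remove : ∀ (xs : List X) {y ys} → Unique (xs ++ y ∷ ys) → y ∉ xs ++ ys × Unique (xs ++ ys)
  Unique-remove xs {y} {ys} u = Unique[x∷xs]⇒x∉xs u′ , drop⁺ 1 u′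
    where u′ = Unique-resp-↭ (shift y xs ys) u

  ∈-remove : ∀ (xs : List X) {y ys z} → z ∈ xs ++ y ∷ ys → z ≢ y → z ∈ xs ++ ys
  ∈-remove xs {y} {ys} z∈ z≢y with ∈-resp-↭ (shift y xs ys) z∈
  ... | here z≡y = ⊥-elim (z≢y z≡y)
  ... | there z∈′ = z∈′

  ∈-insert : ∀ (xs : List X) {y ys z} → z ∈ xs ++ ys → z ∈ xs ++ y ∷ ys
  ∈-insert xs {y} {ys} z∈ = ∈-resp-↭ (↭-sym (shift y xs ys)) (there z∈)

  length-unique-⇔ : ∀ {xs ys : List X} → Unique xs → Unique ys → (∀ {z} → z ∈ xs ⇔ z ∈ ys) → length xs ≡ length ys
  length-unique-⇔ uxs uys xs⇔ys = ↭-length (∼bag⇒↭ (unique∧set⇒bag uxs uys xs⇔ys))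

  consecutive-irrefl : ∀ {xs : List X} {u w} → Unique xs → (u , w) ∈ consecutive xs → u ≢ w
  consecutive-irrefl {x ∷ y ∷ xs} (x∉ ∷ _) (here refl) = All.lookup x∉ (here refl)
  consecutive-irrefl {x ∷ y ∷ xs} (_ ∷ u)  (there uw∈) = consecutive-irrefl u uw∈

  consecutive-asym : ∀ {xs : List X} {u w} → Unique xs → (u , w) ∈ consecutive xs → (w , u) ∉ consecutive xs
  consecutive-asym {x ∷ y ∷ xs} (x∉ ∷ _) (here refl) (here refl)  = All.lookup x∉ (here refl) refl
  consecutive-asym {x ∷ y ∷ xs} (x∉ ∷ _) (here refl) (there yx∈) =
    All.lookup x∉ (proj₂ (∈-consecutive⇒∈ (y ∷ xs) yx∈)) refl
  consecutive-asym {x ∷ y ∷ xs} (x∉ ∷ _) (there uw∈) (here refl) =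
    All.lookup x∉ (proj₂ (∈-consecutive⇒∈ (y ∷ xs) uw∈)) refl
  consecutive-asym {x ∷ y ∷ xs} (_ ∷ u)  (there uw∈) (there wu∈) = consecutive-asym u uw∈ wu∈

  reverse-≢ : ∀ (xs : List X) → 2 ≤ length xs → Unique xs → reverse xs ≢ xs
  reverse-≢ (x ∷ []) (s≤s ())
  reverse-≢ (x ∷ y ∷ xs) _ u eq = consecutive-asym u (here refl)
    (subst (λ l → (y , x) ∈ consecutive l) eq (∈-consecutive-reverse (x ∷ y ∷ xs) (here refl)))

  Unique-map-consecutive : ∀ {Y : Set} (f : X × X → Y) → (∀ {p q} → f p ≡ f q → p ≡ q ⊎ p ≡ swap q) →
                           ∀ {xs} → Unique xs → Unique (map f (consecutive xs))
  Unique-map-consecutive f _   {[]}         _         = []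
  Unique-map-consecutive f _   {x ∷ []}     _         = []
  Unique-map-consecutive f inj {x ∷ y ∷ xs} (x∉ ∷ u) = All.tabulate ≢fxy ∷ Unique-map-consecutive f inj u
    where
    ≢fxy : ∀ {z} → z ∈ map f (consecutive (y ∷ xs)) → f (x , y) ≢ z
    ≢fxy z∈ fxy≡z with _ , uw∈ , refl ← ∈-map⁻ f z∈ with inj fxy≡z | ∈-consecutive⇒∈ (y ∷ xs) uw∈
    ... | inj₁ refl | u∈ , _ = All.lookup x∉ u∈ refl
    ... | inj₂ refl | _ , w∈ = All.lookup x∉ w∈ refl

  ∈-consecutive-++-backward : ∀ B {C} {u w : X} → Unique (B ++ C) → w ∈ B → u ∈ C → (u , w) ∉ consecutive (B ++ C)
  ∈-consecutive-++-backward B {C} uBC w∈B u∈C uw∈ with ∈-consecutive-++⁻ B C uw∈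
  ... | inj₁ uw∈B        = Unique-++⇒disjoint B uBC (proj₁ (∈-consecutive⇒∈ B uw∈B)) u∈C
  ... | inj₂ (inj₁ uw∈J) = Unique-++⇒disjoint B uBC (proj₁ (∈-junction⇒∈ B C uw∈J)) u∈C
  ... | inj₂ (inj₂ uw∈C) = Unique-++⇒disjoint B uBC w∈B (proj₂ (∈-consecutive⇒∈ C uw∈C))

  ∈-consecutive-++-forward : ∀ B {C} {u w : X} → Unique (B ++ C) → u ∈ B → w ∈ C →
                             (u , w) ∈ consecutive (B ++ C) → (u , w) ∈ junction B C
  ∈-consecutive-++-forward B {C} uBC u∈B w∈C uw∈ with ∈-consecutive-++⁻ B C uw∈
  ... | inj₁ uw∈B        = ⊥-elim (Unique-++⇒disjoint B uBC (proj₂ (∈-consecutive⇒∈ B uw∈B)) w∈C)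
  ... | inj₂ (inj₁ uw∈J) = uw∈J
  ... | inj₂ (inj₂ uw∈C) = ⊥-elim (Unique-++⇒disjoint B uBC u∈B (proj₁ (∈-consecutive⇒∈ C uw∈C)))

  head-neighbour : ∀ {y w : X} r → Unique (y ∷ r) → Adjacent (y ∷ r) y w → ∃ λ r′ → r ≡ w ∷ r′
  head-neighbour (c ∷ r) _ (inj₁ (here refl)) = r , refl
  head-neighbour (c ∷ r) u (inj₁ (there yw∈)) = ⊥-elim (Unique[x∷xs]⇒x∉xs u (proj₁ (∈-consecutive⇒∈ (c ∷ r) yw∈)))
  head-neighbour (c ∷ r) u (inj₂ (here refl)) = ⊥-elim (Unique[x∷xs]⇒x∉xs u (here refl))
  head-neighbour (c ∷ r) u (inj₂ (there wy∈)) = ⊥-elim (Unique[x∷xs]⇒x∉xs u (proj₂ (∈-consecutive⇒∈ (c ∷ r) wy∈)))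

-- A path is determined up to reversal by its edges

module _ {X : Set} where

  infix 4 _⊑_
  _⊑_ : List X → List X → Set
  p ⊑ q = ∀ {a b} → (a , b) ∈ consecutive p → Adjacent q a b

  -- If q₁ were nonempty it would start with y, whose only neighbour would then be both x and z.
  insertion-at-front : ∀ q₁ q₂ {x y z : X} {zs} → Unique (q₁ ++ x ∷ q₂) → q₁ ++ q₂ ≡ y ∷ z ∷ zs →
                       Adjacent (q₁ ++ x ∷ q₂) x y → Adjacent (q₁ ++ x ∷ q₂) y z → q₁ ++ x ∷ q₂ ≡ x ∷ y ∷ z ∷ zs
  insertion-at-front []       q₂ _ eq _ _ = cong (_ ∷_) eq
  insertion-at-front (c ∷ q₁) q₂ {x} u eq xy yz with refl ← ∷-injectiveˡ eq
    with _ , r≡x∷ ← head-neighbour (q₁ ++ x ∷ q₂) u (Adjacent-sym xy)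
       | _ , r≡z∷ ← head-neighbour (q₁ ++ x ∷ q₂) u yz
    with refl ← ∷-injectiveˡ (trans (sym r≡x∷) r≡z∷) =
    ⊥-elim (proj₁ (Unique-remove (c ∷ q₁) u) (subst (x ∈_) (sym eq) (there (here refl))))

  ⊑-remove : ∀ {x : X} {p} q₁ q₂ → Unique (x ∷ p) → x ∷ p ⊑ q₁ ++ x ∷ q₂ → p ⊑ q₁ ++ q₂
  ⊑-remove {x} {p} q₁ q₂ u xp⊑q {a} {b} ab∈ =
    Sum.map (∈-consecutive-remove q₁ q₂ (≢x a∈) (≢x b∈)) (∈-consecutive-remove q₁ q₂ (≢x b∈) (≢x a∈))
            (xp⊑q (∈-consecutive-∷ p ab∈))
    where
    ≢x : ∀ {c} → c ∈ p → c ≢ x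
    ≢x c∈ refl = Unique[x∷xs]⇒x∉xs u c∈
    a∈ = proj₁ (∈-consecutive⇒∈ p ab∈)
    b∈ = proj₂ (∈-consecutive⇒∈ p ab∈)

  ⊑-insert : ∀ q₁ q₂ {x y z : X} {p} → Unique (q₁ ++ x ∷ q₂) → x ∷ y ∷ z ∷ p ⊑ q₁ ++ x ∷ q₂ →
             q₁ ++ q₂ ≡ y ∷ z ∷ p ⊎ q₁ ++ q₂ ≡ reverse (y ∷ z ∷ p) →
             q₁ ++ x ∷ q₂ ≡ x ∷ y ∷ z ∷ p ⊎ q₁ ++ x ∷ q₂ ≡ reverse (x ∷ y ∷ z ∷ p)
  ⊑-insert q₁ q₂ u p⊑q (inj₁ q′≡p′) =
    inj₁ (insertion-at-front q₁ q₂ u q′≡p′ (p⊑q (here refl)) (p⊑q (there (here refl))))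
  ⊑-insert q₁ q₂ {x} {y} {z} {p} u p⊑q (inj₂ q′≡p′ᴿ) = inj₂ (begin
    q₁ ++ x ∷ q₂                     ≡⟨ sym (reverse-involutive _) ⟩
    reverse (reverse (q₁ ++ x ∷ q₂)) ≡⟨ cong reverse reversed ⟩
    reverse (x ∷ y ∷ z ∷ p)          ∎)
    where
    open ≡-Reasoning
    qᴿ≡ : reverse (q₁ ++ x ∷ q₂) ≡ reverse q₂ ++ x ∷ reverse q₁
    qᴿ≡ = reverse-++-∷ q₁ x q₂
    adjacentᴿ : ∀ {a b} → Adjacent (q₁ ++ x ∷ q₂) a b → Adjacent (reverse q₂ ++ x ∷ reverse q₁) a b
    adjacentᴿ {a} {b} = subst (λ l → Adjacent l a b) qᴿ≡ ∘ Adjacent-reverse (q₁ ++ x ∷ q₂)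
    reversed : reverse (q₁ ++ x ∷ q₂) ≡ x ∷ y ∷ z ∷ p
    reversed = trans qᴿ≡ (insertion-at-front (reverse q₂) (reverse q₁)
      (subst Unique qᴿ≡ (Unique-resp-↭ (↭-sym (↭-reverse (q₁ ++ x ∷ q₂))) u))
      (trans (sym (reverse-++ q₁ q₂)) (trans (cong reverse q′≡p′ᴿ) (reverse-involutive _)))
      (adjacentᴿ (p⊑q (here refl))) (adjacentᴿ (p⊑q (there (here refl)))))

  Rigid : List X → Set
  Rigid p = ∀ q → 2 ≤ length p → length p ≡ length q → Unique p → Unique q → p ⊑ q → q ≡ p ⊎ q ≡ reverse p

  Rigid-∷ : ∀ {x y z : X} {p} → Rigid (y ∷ z ∷ p) → Rigid (x ∷ y ∷ z ∷ p)
  Rigid-∷ {x} rigid q _ len up uq p⊑q with q₁ , q₂ , refl ← ∈-∃++ (Adjacent⇒∈ (p⊑q (here refl))) =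
    ⊑-insert q₁ q₂ uq p⊑q (rigid (q₁ ++ q₂) (s≤s (s≤s z≤n))
      (suc-injective (trans len (↭-length (shift x q₁ q₂))))
      (drop⁺ 1 up) (proj₂ (Unique-remove q₁ uq)) (⊑-remove q₁ q₂ up p⊑q))

  ⊑⇒≡∨≡reverse : ∀ p → Rigid p
  ⊑⇒≡∨≡reverse (x ∷ []) _ (s≤s ())
  ⊑⇒≡∨≡reverse (x ∷ y ∷ []) (c ∷ d ∷ []) _ _ _ _ p⊑q with p⊑q (here refl)
  ... | inj₁ (here refl) = inj₁ refl
  ... | inj₂ (here refl) = inj₂ refl
  ⊑⇒≡∨≡reverse (x ∷ y ∷ z ∷ p) = Rigid-∷ (⊑⇒≡∨≡reverse (y ∷ z ∷ p))

-- Fixed-point-free involutions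

module _ {X : Set} where

  Matched : (X → X) → List X → X → Set
  Matched σ xs x = σ x ∈ xs × σ (σ x) ≡ x × σ x ≢ x

  PairsUp : (X → X) → List X → Set
  PairsUp σ xs = ∀ {x} → x ∈ xs → Matched σ xs x

  PairsUp⇒even : ∀ {σ xs} → Unique xs → PairsUp σ xs → 2 ∣ length xs
  PairsUp⇒even {σ} {xs} = go (length xs) xs ≤-refl
    where
    go : ∀ k xs → length xs ≤ k → Unique xs → PairsUp σ xs → 2 ∣ length xs
    go _       []        _             _   _     = divides 0 refl
    go (suc k) (x ∷ xs′) (s≤s |xs′|≤k) uxs pairs with pairs (here refl)
    ... | here σx≡x , _ , σx≢x = ⊥-elim (σx≢x σx≡x)
    ... | there σx∈ , σσx≡x , _ with ys₁ , ys₂ , refl ← ∈-∃++ σx∈ =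
      subst (2 ∣_) (cong suc (sym |xs′|≡)) (∣m∣n⇒∣m+n ∣-refl (go k (ys₁ ++ ys₂) ≤k (proj₂ rest) rest-pairs))
      where
      |xs′|≡ : length (ys₁ ++ σ x ∷ ys₂) ≡ suc (length (ys₁ ++ ys₂))
      |xs′|≡ = ↭-length (shift (σ x) ys₁ ys₂)
      ≤k : length (ys₁ ++ ys₂) ≤ k
      ≤k = ≤-trans (n≤1+n _) (subst (_≤ k) |xs′|≡ |xs′|≤k)
      rest : σ x ∉ ys₁ ++ ys₂ × Unique (ys₁ ++ ys₂)
      rest = Unique-remove ys₁ (drop⁺ 1 uxs)
      rest-pairs : PairsUp σ (ys₁ ++ ys₂)
      rest-pairs {y} y∈ with pairs (there (∈-insert ys₁ y∈))
      ... | here σy≡x , σσy≡y , _ =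
        ⊥-elim (proj₁ rest (subst (_∈ ys₁ ++ ys₂) (trans (sym σσy≡y) (cong σ σy≡x)) y∈))
      ... | there σy∈ , σσy≡y , σy≢y = ∈-remove ys₁ σy∈ σy≢σx , σσy≡y , σy≢y
        where
        σy≢σx : σ y ≢ σ x
        σy≢σx σy≡σx = Unique[x∷xs]⇒x∉xs uxs
          (subst (_∈ ys₁ ++ σ x ∷ ys₂) (trans (sym σσy≡y) (trans (cong σ σy≡σx) σσx≡x)) (∈-insert ys₁ y∈))

-- Maximal blocks of a list under a decidable relation

module Blocks {X : Set} {_~_ : X → X → Set} (_~?_ : Decidable _~_) where

  Chain : List X → Set
  Chain xs = ∀ {u w} → (u , w) ∈ consecutive xs → u ~ w

  Cut : List X → List X → Set
  Cut xs ys = ∀ {u w} → (u , w) ∈ junction xs ys → ¬ u ~ w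

  Realizes : List X → Set
  Realizes xs = ∀ {u w} → u ~ w → (u , w) ∈ consecutive xs ⊎ (w , u) ∈ consecutive xs × w ~ u

  Cut-[] : ∀ xs → Cut xs []
  Cut-[] (_ ∷ y ∷ xs) uw∈ = Cut-[] (y ∷ xs) uw∈

  block : X → List X → List X × List X
  block x []       = [] , []
  block x (y ∷ ys) with x ~? y
  ... | yes _ = map₁ (y ∷_) (block y ys)
  ... | no _  = [] , y ∷ ys

  block-split : ∀ x xs → ∃₂ λ b s → xs ≡ b ++ s × Chain (x ∷ b) × Cut (x ∷ b) s
  block-split x [] = [] , [] , refl , (λ ()) , (λ ())
  block-split x (y ∷ ys) with x ~? y
  ... | no ¬x~y = [] , y ∷ ys , refl , (λ ()) , λ { (here refl) → ¬x~y }
  ... | yes x~y with b , s , eq , chain , cut ← block-split y ys =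
    y ∷ b , s , cong (y ∷_) eq , (λ { (here refl) → x~y ; (there uw∈) → chain uw∈ }) , cut

  block-++ : ∀ x b s → Chain (x ∷ b) → Cut (x ∷ b) s → block x (b ++ s) ≡ (b , s)
  block-++ x []      []      _     _   = refl
  block-++ x []      (y ∷ s) _     cut with x ~? y
  ... | yes x~y = ⊥-elim (cut (here refl) x~y)
  ... | no _    = refl
  block-++ x (y ∷ b) s       chain cut with x ~? y
  ... | yes _   rewrite block-++ y b s (chain ∘ there) cut = refl
  ... | no ¬x~y = ⊥-elim (¬x~y (chain (here refl)))

  -- A single block is reversed; that is an involution only when _~_ is symmetric.
  swapBlocks : List X → List X
  swapBlocks [] = []
  swapBlocks (x ∷ xs) with block x xs
  ... | b₁ , []     = reverse (x ∷ xs)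
  ... | b₁ , y ∷ ys with block y ys
  ...   | b₂ , r = (y ∷ b₂) ++ (x ∷ b₁) ++ r

  block-chain : ∀ x b → Chain (x ∷ b) → block x b ≡ (b , [])
  block-chain x b chain = subst (λ l → block x l ≡ (b , [])) (++-identityʳ b) (block-++ x b [] chain (Cut-[] (x ∷ b)))

  swapBlocks-chain : ∀ xs → Chain xs → swapBlocks xs ≡ reverse xs
  swapBlocks-chain []       _     = refl
  swapBlocks-chain (x ∷ xs) chain rewrite block-chain x xs chain = refl

  record Swapped (xs : List X) : Set where
    field
      permutation      : swapBlocks xs ↭ xs
      involutive       : swapBlocks (swapBlocks xs) ≡ xs
      fixed-point-free : swapBlocks xs ≢ xs
      keeps-chains     : ∀ {u w} → (u , w) ∈ consecutive xs → u ~ w → (u , w) ∈ consecutive (swapBlocks xs)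

  swapped : ∀ x b₁ y b₂ r → Chain (x ∷ b₁) → Cut (x ∷ b₁) (y ∷ b₂ ++ r) → Chain (y ∷ b₂) → Cut (y ∷ b₂) r →
            Unique ((x ∷ b₁) ++ (y ∷ b₂) ++ r) → Realizes ((x ∷ b₁) ++ (y ∷ b₂) ++ r) →
            Swapped ((x ∷ b₁) ++ (y ∷ b₂) ++ r)
  swapped x b₁ y b₂ r chain₁ cut₁ chain₂ cut₂ uxs realizes = record
    { permutation      = subst (_↭ _) (sym swap-xs) (shifts B₂ B₁)
    ; involutive       = trans (cong swapBlocks swap-xs) swap-ys
    ; fixed-point-free = λ eq → Unique-++⇒disjoint B₁ uxs (here refl) (here (∷-injectiveˡ (trans (sym eq) swap-xs)))
    ; keeps-chains     = λ uw∈ u~w → subst (λ l → _ ∈ consecutive l) (sym swap-xs) (keeps uw∈ u~w)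
    }
    where
    B₁ = x ∷ b₁
    B₂ = y ∷ b₂
    swap-xs : swapBlocks (B₁ ++ B₂ ++ r) ≡ B₂ ++ B₁ ++ r
    swap-xs rewrite block-++ x b₁ (B₂ ++ r) chain₁ cut₁ | block-++ y b₂ r chain₂ cut₂ = refl
    -- The exchanged blocks stay maximal: by `realizes`, a related pair across a new boundary is adjacent in xs.
    cut₂₁ : Cut B₂ (B₁ ++ r)
    cut₂₁ uw∈J u~w with u∈B₂ , _ ← ∈-junction⇒∈ B₂ (B₁ ++ r) uw∈J
                   with refl ← ∈-junction⇒head B₂ x (b₁ ++ r) uw∈J with realizes u~w
    ... | inj₁ ux∈        = ∈-consecutive-++-backward B₁ uxs (here refl) (∈-++⁺ˡ u∈B₂) ux∈
    ... | inj₂ (xu∈ , x~u) = cut₁ (∈-consecutive-++-forward B₁ uxs (here refl) (∈-++⁺ˡ u∈B₂) xu∈) x~u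
    cut₁r : Cut B₁ r
    cut₁r uw∈J u~w with u∈B₁ , w∈r ← ∈-junction⇒∈ B₁ r uw∈J with realizes u~w
    ... | inj₁ uw∈
      with refl ← ∈-junction⇒head B₁ y (b₂ ++ r) (∈-consecutive-++-forward B₁ uxs u∈B₁ (∈-++⁺ʳ B₂ w∈r) uw∈) =
      Unique-++⇒disjoint B₂ (Unique-resp-↭ (shifts B₁ B₂) uxs) (here refl) (∈-++⁺ʳ B₁ w∈r)
    ... | inj₂ (wu∈ , _) = ∈-consecutive-++-backward B₁ uxs u∈B₁ (∈-++⁺ʳ B₂ w∈r) wu∈
    swap-ys : swapBlocks (B₂ ++ B₁ ++ r) ≡ B₁ ++ B₂ ++ r
    swap-ys rewrite block-++ y b₂ (B₁ ++ r) chain₂ cut₂₁ | block-++ x b₁ r chain₁ cut₁r = refl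
    keeps : ∀ {u w} → (u , w) ∈ consecutive (B₁ ++ B₂ ++ r) → u ~ w → (u , w) ∈ consecutive (B₂ ++ B₁ ++ r)
    keeps uw∈ u~w with ∈-consecutive-++⁻ B₁ (B₂ ++ r) uw∈
    ... | inj₁ uw∈B₁        = ∈-consecutive-++⁺ʳ B₂ (B₁ ++ r) (∈-consecutive-++⁺ˡ B₁ r uw∈B₁)
    ... | inj₂ (inj₁ uw∈J)  = ⊥-elim (cut₁ uw∈J u~w)
    ... | inj₂ (inj₂ uw∈B₂r) with ∈-consecutive-++⁻ B₂ r uw∈B₂r
    ...   | inj₁ uw∈B₂        = ∈-consecutive-++⁺ˡ B₂ (B₁ ++ r) uw∈B₂
    ...   | inj₂ (inj₁ uw∈J)  = ⊥-elim (cut₂ uw∈J u~w)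
    ...   | inj₂ (inj₂ uw∈r)  = ∈-consecutive-++⁺ʳ B₂ (B₁ ++ r) (∈-consecutive-++⁺ʳ B₁ r uw∈r)

  chain⊎swapped : ∀ xs → Unique xs → Realizes xs → Chain xs ⊎ Swapped xs
  chain⊎swapped []       _   _        = inj₁ λ ()
  chain⊎swapped (x ∷ xs) uxs realizes with block-split x xs
  ... | b₁ , [] , refl , chain₁ , _ = inj₁ (subst (Chain ∘ (x ∷_)) (sym (++-identityʳ b₁)) chain₁)
  ... | b₁ , y ∷ s , refl , chain₁ , cut₁ with b₂ , r , refl , chain₂ , cut₂ ← block-split y s =
    inj₂ (swapped x b₁ y b₂ r chain₁ cut₁ chain₂ cut₂ uxs realizes)

module _ {n : ℕ} where

  vecs-complete : ∀ {k} (v : Vec (Fin n) k) → v ∈ vecs n k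
  vecs-complete []      = here refl
  vecs-complete (x ∷ v) = ∈-concatMap⁺ _ (Any.map (λ { refl → ∈-map⁺ (x ∷_) (vecs-complete v) }) (∈-allFin x))

  vecs-unique : ∀ k → Unique (vecs n k)
  vecs-unique zero    = [] ∷ []
  vecs-unique (suc k) = Uniqueₚ.concat⁺
    (Allₚ.map⁺ (All.tabulate λ _ → Uniqueₚ.map⁺ Vecₚ.∷-injectiveʳ (vecs-unique k)))
    (AllPairsₚ.map⁺ (AllPairs.map disjoint (Uniqueₚ.allFin⁺ n)))
    where
    disjoint : ∀ {x y} → x ≢ y → Disjoint (map (x ∷_) (vecs n k)) (map (y ∷_) (vecs n k))
    disjoint x≢y (v∈ , v∈′) with _ , _ , refl ← ∈-map⁻ _ v∈ | _ , _ , eq ← ∈-map⁻ _ v∈′ =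
      x≢y (Vecₚ.∷-injectiveˡ eq)

  toList-surjective : ∀ {k} (xs : List (Fin n)) → length xs ≡ k → ∃ λ (v : Vec (Fin n) k) → toList v ≡ xs
  toList-surjective xs eq = cast eq (fromList xs) , trans (toList-cast eq (fromList xs)) (toList∘fromList xs)

  consec≡consecutive : ∀ {k} (v : Vec (Fin n) k) → consec v ≡ consecutive (toList v)
  consec≡consecutive []          = refl
  consec≡consecutive (x ∷ [])    = refl
  consec≡consecutive (x ∷ y ∷ v) = cong ((x , y) ∷_) (consec≡consecutive (y ∷ v))

  notIn⇒All≢ : ∀ {k} x (v : Vec (Fin n) k) → T (notIn x v) → All (x ≢_) (toList v)
  notIn⇒All≢ x []      _ = []
  notIn⇒All≢ x (y ∷ v) t with x ≟ y
  ... | yes _   = ⊥-elim t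
  ... | no x≢y = x≢y ∷ notIn⇒All≢ x v t

  All≢⇒notIn : ∀ {k} x (v : Vec (Fin n) k) → All (x ≢_) (toList v) → T (notIn x v)
  All≢⇒notIn x []      _            = _
  All≢⇒notIn x (y ∷ v) (x≢y ∷ x∉v) with x ≟ y
  ... | yes x≡y = x≢y x≡y
  ... | no _    = All≢⇒notIn x v x∉v

  distinct⇒Unique : ∀ {k} (v : Vec (Fin n) k) → T (distinct v) → Unique (toList v)
  distinct⇒Unique []      _ = []
  distinct⇒Unique (x ∷ v) t with t₁ , t₂ ← to T-∧ t = notIn⇒All≢ x v t₁ ∷ distinct⇒Unique v t₂

  Unique⇒distinct : ∀ {k} (v : Vec (Fin n) k) → Unique (toList v) → T (distinct v)
  Unique⇒distinct []      _          = _
  Unique⇒distinct (x ∷ v) (x∉v ∷ u) = from T-∧ (All≢⇒notIn x v x∉v , Unique⇒distinct v u)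

T-not-∨ : ∀ {x y} → T (not x ∨ y) ⇔ (T x → T y)
T-not-∨ {true}  = mk⇔ (λ ty _ → ty) (λ f → f _)
T-not-∨ {false} = mk⇔ (λ _ ()) (λ _ → _)

module _ {n : ℕ} where

  ∈-allPairs : ∀ (a b : Fin n) → (a , b) ∈ allPairs n
  ∈-allPairs a b = ∈-cartesianProduct⁺ (∈-allFin a) (∈-allFin b)

  T-all-allPairs : ∀ {p : Fin n × Fin n → Bool} → T (all p (allPairs n)) ⇔ (∀ a b → T (p (a , b)))
  T-all-allPairs {p} = mk⇔ (λ t a b → All.lookup (all⁺ p _ t) (∈-allPairs a b))
                           (λ f → all⁻ p {xs = allPairs n} (All.tabulate λ {(a , b)} _ → f a b))

  eqF²-refl : ∀ {a b : Fin n} → T (eqF a a ∧ eqF b b)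
  eqF²-refl {a} {b} = from (T-∧ {eqF a a} {eqF b b}) (fromWitness refl , fromWitness refl)

  eqF²⇒≡ : ∀ {u w a b : Fin n} → T (eqF u a ∧ eqF w b) → (u , w) ≡ (a , b)
  eqF²⇒≡ {u} {w} {a} {b} t with tu , tw ← to (T-∧ {eqF u a} {eqF w b}) t =
    cong₂ _,_ (toWitness tu) (toWitness tw)

  module _ {a b : Fin n} (ps : List (Fin n × Fin n)) where

    T-any-ordered : T (any (λ { (u , w) → eqF u a ∧ eqF w b }) ps) ⇔ (a , b) ∈ ps
    T-any-ordered = mk⇔ any⇒∈ (λ ab∈ → any⁺ _ (Any.map (λ { refl → eqF²-refl {a} {b} }) ab∈))
      where
      any⇒∈ : T (any (λ { (u , w) → eqF u a ∧ eqF w b }) ps) → (a , b) ∈ ps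
      any⇒∈ t with _ , uw∈ , tuw ← find (any⁻ _ ps t) = subst (_∈ ps) (eqF²⇒≡ tuw) uw∈

    T-any-unordered : T (any (λ { (u , w) → (eqF u a ∧ eqF w b) ∨ (eqF u b ∧ eqF w a) }) ps) ⇔
                      ((a , b) ∈ ps ⊎ (b , a) ∈ ps)
    T-any-unordered = mk⇔ any⇒∈ ∈⇒any
      where
      any⇒∈ : T (any (λ { (u , w) → (eqF u a ∧ eqF w b) ∨ (eqF u b ∧ eqF w a) }) ps) → (a , b) ∈ ps ⊎ (b , a) ∈ ps
      any⇒∈ t with (u , w) , uw∈ , tuw ← find (any⁻ _ ps t)
           with to (T-∨ {eqF u a ∧ eqF w b} {eqF u b ∧ eqF w a}) tuw
      ... | inj₁ ≡ab = inj₁ (subst (_∈ ps) (eqF²⇒≡ ≡ab) uw∈)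
      ... | inj₂ ≡ba = inj₂ (subst (_∈ ps) (eqF²⇒≡ ≡ba) uw∈)
      ∈⇒any : (a , b) ∈ ps ⊎ (b , a) ∈ ps → T (any (λ { (u , w) → (eqF u a ∧ eqF w b) ∨ (eqF u b ∧ eqF w a) }) ps)
      ∈⇒any (inj₁ ab∈) =
        any⁺ _ (Any.map (λ { refl → from (T-∨ {eqF a a ∧ eqF b b}) (inj₁ (eqF²-refl {a} {b})) }) ab∈)
      ∈⇒any (inj₂ ba∈) =
        any⁺ _ (Any.map (λ { refl → from (T-∨ {eqF b a ∧ eqF a b}) (inj₂ (eqF²-refl {b} {a})) }) ba∈)

isE₁₂∧isBack⇒⊥ : ∀ k → T (isE₁₂ k) → T (isBack k) → ⊥
isE₁₂∧isBack⇒⊥ backward () _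

module _ {n : ℕ} (G : MixedGraph n) {A D : Fin n → Fin n → Bool} (validA : ValidA G A) (validD : ValidD G D) where
  open ValidA validA
  open ValidD validD

  A-D-disjoint : ∀ {a b} → T (A a b) → T (D a b) → ⊥
  A-D-disjoint {a} {b} ta td = isE₁₂∧isBack⇒⊥ (kind G a b) (A-sub a b ta) (proj₂ (D-sub a b td))

  Required : Fin n → Fin n → Set
  Required u w = T (A u w ∨ D u w)

  open Blocks {_~_ = Required} (λ u w → T? (A u w ∨ D u w))

  Covering : List (Fin n) → Set
  Covering xs = (∀ {a b} → T (A a b) → Adjacent xs a b) × (∀ {a b} → T (D a b) → (a , b) ∈ consecutive xs)

  module _ (v : Vec (Fin n) n) where

    private
      consec⇔ : ∀ {p} → p ∈ consec v ⇔ p ∈ consecutive (toList v)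
      consec⇔ {p} = mk⇔ (subst (p ∈_) (consec≡consecutive v)) (subst (p ∈_) (sym (consec≡consecutive v)))

    covers⇒Covering : T (Covers A D v) → Covering (toList v)
    covers⇒Covering t with tA , tD ← to T-∧ t =
      (λ {a} {b} ta → Sum.map (to consec⇔) (to consec⇔)
          (to (T-any-unordered (consec v)) (to T-not-∨ (to T-all-allPairs tA a b) ta))) ,
      (λ {a} {b} td → to consec⇔
          (to (T-any-ordered (consec v)) (to T-not-∨ (to T-all-allPairs tD a b) td)))

    Covering⇒covers : Covering (toList v) → T (Covers A D v)
    Covering⇒covers (coverA , coverD) = from T-∧
      ( from T-all-allPairs (λ a b → from T-not-∨ λ ta →
          from (T-any-unordered (consec v)) (Sum.map (from consec⇔) (from consec⇔) (coverA {a} {b} ta)))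
      , from T-all-allPairs (λ a b → from T-not-∨ λ td →
          from (T-any-ordered (consec v)) (from consec⇔ (coverD {a} {b} td))))

    within⇒Chain : T (Within G A D v) → Chain (toList v)
    within⇒Chain t {u} {w} uw∈ with to T-∨ (All.lookup (all⁺ _ _ t) (from consec⇔ uw∈))
    ... | inj₁ tA = from T-∨ (inj₁ (proj₂ (to (T-∧ {isE₁₂ (kind G u w)}) tA)))
    ... | inj₂ tD = from T-∨ (inj₂ (proj₂ (to (T-∧ {isBack (kind G u w)}) tD)))

    Chain⇒within : Chain (toList v) → T (Within G A D v)
    Chain⇒within chain =
      all⁻ _ {xs = consec v} (All.tabulate λ {(u , w)} uw∈ → within-pair (chain (to consec⇔ uw∈)))
      where
      within-pair : ∀ {u w} → Required u w → T ((isE₁₂ (kind G u w) ∧ A u w) ∨ (isBack (kind G u w) ∧ D u w))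
      within-pair {u} {w} r with to (T-∨ {A u w}) r
      ... | inj₁ ta = from T-∨ (inj₁ (from T-∧ (A-sub u w ta , ta)))
      ... | inj₂ td = from (T-∨ {isE₁₂ (kind G u w) ∧ A u w}) (inj₂ (from T-∧ (proj₂ (D-sub u w td) , td)))

  coveringPermutationᵇ : Vec (Fin n) n → Bool
  coveringPermutationᵇ v = IsPerm v ∧ Covers A D v

  coveringPermutations : List (List (Fin n))
  coveringPermutations = map toList (filterᵇ coveringPermutationᵇ (vecs n n))

  IsCoveringPermutation : List (Fin n) → Set
  IsCoveringPermutation xs = length xs ≡ n × Unique xs × Covering xs

  ∈-coveringPermutations⁻ : ∀ {xs} → xs ∈ coveringPermutations → IsCoveringPermutation xs
  ∈-coveringPermutations⁻ xs∈ with v , v∈ , refl ← ∈-map⁻ toList xs∈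
    with _ , t ← ∈-filter⁻ (T? ∘ coveringPermutationᵇ) {xs = vecs n n} v∈
    with tp , tc ← to T-∧ t = length-toList v , distinct⇒Unique v tp , covers⇒Covering v tc

  ∈-coveringPermutations⁺ : ∀ {xs} → IsCoveringPermutation xs → xs ∈ coveringPermutations
  ∈-coveringPermutations⁺ {xs} (len , uxs , cov) with v , refl ← toList-surjective xs len =
    ∈-map⁺ toList (∈-filter⁺ (T? ∘ coveringPermutationᵇ) {xs = vecs n n} (vecs-complete v)
                             (from T-∧ (Unique⇒distinct v uxs , Covering⇒covers v cov)))

  coveringPermutations-unique : Unique coveringPermutations
  coveringPermutations-unique =
    Uniqueₚ.map⁺ (λ {v} {w} eq → trans (sym (cast-is-id refl v)) (toList-injective refl v w eq))
                 (Uniqueₚ.filter⁺ _ (vecs-unique n))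

  Covering⇒Realizes : ∀ {xs} → Covering xs → Realizes xs
  Covering⇒Realizes (coverA , coverD) {u} {w} r with to (T-∨ {A u w}) r
  ... | inj₂ td = inj₁ (coverD td)
  ... | inj₁ ta with coverA ta
  ...   | inj₁ uw∈ = inj₁ uw∈
  ...   | inj₂ wu∈ = inj₂ (wu∈ , from T-∨ (inj₁ (subst T (A-sym u w) ta)))

  Covering⇒Adjacent : ∀ {xs u w} → Covering xs → Required u w → Adjacent xs u w
  Covering⇒Adjacent cov r with Covering⇒Realizes cov r
  ... | inj₁ uw∈       = inj₁ uw∈
  ... | inj₂ (wu∈ , _) = inj₂ wu∈

  Covering-transfer : ∀ {xs ys} → (∀ {u w} → (u , w) ∈ consecutive xs → Required u w → (u , w) ∈ consecutive ys) →
                      Covering xs → Covering ys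
  Covering-transfer keeps (coverA , coverD) = coverA′ , λ td → keeps (coverD td) (from T-∨ (inj₂ td))
    where
    coverA′ : ∀ {a b} → T (A a b) → Adjacent _ a b
    coverA′ {a} {b} ta with coverA ta
    ... | inj₁ ab∈ = inj₁ (keeps ab∈ (from T-∨ (inj₁ ta)))
    ... | inj₂ ba∈ = inj₂ (keeps ba∈ (from T-∨ (inj₁ (subst T (A-sym a b) ta))))

  -- Sends a neighbouring pair of a single block to the entry counting it in cardA (u < w) or cardD.
  orient : Fin n × Fin n → Fin n × Fin n
  orient (u , w) = if D u w ∨ ⌊ u <? w ⌋ then (u , w) else (w , u)

  orient-kept : ∀ {u w} → T (D u w ∨ ⌊ u <? w ⌋) → orient (u , w) ≡ (u , w)
  orient-kept {u} {w} t with D u w ∨ ⌊ u <? w ⌋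
  ... | true = refl

  orient-flipped : ∀ {u w} → ¬ T (D u w ∨ ⌊ u <? w ⌋) → orient (u , w) ≡ (w , u)
  orient-flipped {u} {w} ¬t with D u w ∨ ⌊ u <? w ⌋
  ... | true  = ⊥-elim (¬t _)
  ... | false = refl

  orient-kept⊎flipped : ∀ p → orient p ≡ p ⊎ orient p ≡ swap p
  orient-kept⊎flipped (u , w) with D u w ∨ ⌊ u <? w ⌋
  ... | true  = inj₁ refl
  ... | false = inj₂ refl

  orient-injective : ∀ {p q} → orient p ≡ orient q → p ≡ q ⊎ p ≡ swap q
  orient-injective {p} {q} eq with orient-kept⊎flipped p | orient-kept⊎flipped q
  ... | inj₁ p≡ | inj₁ q≡ = inj₁ (trans (sym p≡) (trans eq q≡))
  ... | inj₁ p≡ | inj₂ q≡ = inj₂ (trans (sym p≡) (trans eq q≡))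
  ... | inj₂ p≡ | inj₁ q≡ = inj₂ (cong swap (trans (sym p≡) (trans eq q≡)))
  ... | inj₂ p≡ | inj₂ q≡ = inj₁ (cong swap (trans (sym p≡) (trans eq q≡)))

  isAPair isDPair : Fin n × Fin n → Bool
  isAPair (x , y) = ⌊ x <? y ⌋ ∧ A x y
  isDPair (x , y) = D x y

  aPairs dPairs : List (Fin n × Fin n)
  aPairs = filterᵇ isAPair (allPairs n)
  dPairs = filterᵇ isDPair (allPairs n)

  ∈-aPairs⁺ : ∀ {a b} → a < b → T (A a b) → (a , b) ∈ aPairs
  ∈-aPairs⁺ {a} {b} a<b ta =
    ∈-filter⁺ (T? ∘ isAPair) {xs = allPairs n} (∈-allPairs a b) (from T-∧ (fromWitness a<b , ta))

  ∈-aPairs⁻ : ∀ {a b} → (a , b) ∈ aPairs → a < b × T (A a b)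
  ∈-aPairs⁻ {a} {b} ab∈ with t< , ta ← to (T-∧ {⌊ a <? b ⌋}) (proj₂ (∈-filter⁻ (T? ∘ isAPair) {xs = allPairs n} ab∈)) =
    toWitness t< , ta

  ∈-dPairs⁺ : ∀ {a b} → T (D a b) → (a , b) ∈ dPairs
  ∈-dPairs⁺ {a} {b} = ∈-filter⁺ (T? ∘ isDPair) {xs = allPairs n} (∈-allPairs a b)

  ∈-dPairs⁻ : ∀ {a b} → (a , b) ∈ dPairs → T (D a b)
  ∈-dPairs⁻ = proj₂ ∘ ∈-filter⁻ (T? ∘ isDPair) {xs = allPairs n}

  allPairs-unique : Unique (allPairs n)
  allPairs-unique = Uniqueₚ.cartesianProduct⁺ (Uniqueₚ.allFin⁺ n) (Uniqueₚ.allFin⁺ n)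

  requiredPairs : List (Fin n × Fin n)
  requiredPairs = aPairs ++ dPairs

  requiredPairs-unique : Unique requiredPairs
  requiredPairs-unique = Uniqueₚ.++⁺ (Uniqueₚ.filter⁺ _ allPairs-unique) (Uniqueₚ.filter⁺ _ allPairs-unique)
    λ { {a , b} (ab∈A , ab∈D) → A-D-disjoint (proj₂ (∈-aPairs⁻ ab∈A)) (∈-dPairs⁻ ab∈D) }

  module _ {xs} (uxs : Unique xs) (cov : Covering xs) (chain : Chain xs) where

    ∈-requiredPairs⇒ : ∀ {a b} → (a , b) ∈ requiredPairs → (a , b) ∈ map orient (consecutive xs)
    ∈-requiredPairs⇒ {a} {b} ab∈ with ∈-++⁻ aPairs ab∈
    ... | inj₂ ab∈D = subst (_∈ _) (orient-kept (from T-∨ (inj₁ td))) (∈-map⁺ orient (proj₂ cov td))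
      where td = ∈-dPairs⁻ ab∈D
    ... | inj₁ ab∈A with a<b , ta ← ∈-aPairs⁻ ab∈A with proj₁ cov ta
    ...   | inj₁ ab∈ =
      subst (_∈ _) (orient-kept (from (T-∨ {D a b}) (inj₂ (fromWitness a<b)))) (∈-map⁺ orient ab∈)
    ...   | inj₂ ba∈ = subst (_∈ _) (orient-flipped ¬kept) (∈-map⁺ orient ba∈)
      where
      ¬kept : ¬ T (D b a ∨ ⌊ b <? a ⌋)
      ¬kept t with to (T-∨ {D b a}) t
      ... | inj₁ td  = A-D-disjoint (subst T (A-sym a b) ta) td
      ... | inj₂ b<a = <-asym a<b (toWitness b<a)

    ∈-requiredPairs⇐ : ∀ {a b} → (a , b) ∈ map orient (consecutive xs) → (a , b) ∈ requiredPairs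
    ∈-requiredPairs⇐ ab∈ with (u , w) , uw∈ , refl ← ∈-map⁻ orient ab∈ with to (T-∨ {A u w}) (chain uw∈)
    ... | inj₂ td = ∈-++⁺ʳ aPairs (subst (_∈ dPairs) (sym (orient-kept (from T-∨ (inj₁ td)))) (∈-dPairs⁺ td))
    ... | inj₁ ta with <-cmp u w
    ...   | tri< u<w _ _ =
      ∈-++⁺ˡ (subst (_∈ aPairs) (sym (orient-kept (from (T-∨ {D u w}) (inj₂ (fromWitness u<w)))))
                    (∈-aPairs⁺ u<w ta))
    ...   | tri≈ _ u≡w _ = ⊥-elim (consecutive-irrefl uxs uw∈ u≡w)
    ...   | tri> ¬u<w _ w<u =
      ∈-++⁺ˡ (subst (_∈ aPairs) (sym (orient-flipped ¬kept)) (∈-aPairs⁺ w<u (subst T (A-sym u w) ta)))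
      where
      ¬kept : ¬ T (D u w ∨ ⌊ u <? w ⌋)
      ¬kept t with to (T-∨ {D u w}) t
      ... | inj₁ td  = A-D-disjoint ta td
      ... | inj₂ u<w = ¬u<w (toWitness u<w)

  chain⇒cardA+cardD : ∀ {xs} → IsCoveringPermutation xs → Chain xs → cardA A + cardD D ≡ n ∸ 1
  chain⇒cardA+cardD {xs} (len , uxs , cov) chain = begin
    cardA A + cardD D                    ≡⟨ sym (length-++ aPairs) ⟩
    length requiredPairs                 ≡⟨ length-unique-⇔ requiredPairs-unique
                                              (Unique-map-consecutive orient orient-injective uxs)
                                              (mk⇔ (∈-requiredPairs⇒ uxs cov chain) (∈-requiredPairs⇐ uxs cov chain)) ⟩
    length (map orient (consecutive xs)) ≡⟨ length-map orient (consecutive xs) ⟩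
    length (consecutive xs)              ≡⟨ length-consecutive xs ⟩
    length xs ∸ 1                        ≡⟨ cong (_∸ 1) len ⟩
    n ∸ 1                                ∎
    where open ≡-Reasoning

  countN≡length : countN A D ≡ length coveringPermutations
  countN≡length = sym (length-map toList (filterᵇ coveringPermutationᵇ (vecs n n)))

  D-pair⇒1≤cardD : ∀ {a b} → T (D a b) → 1 ≤ cardD D
  D-pair⇒1≤cardD td = ∈⇒1≤length (∈-dPairs⁺ td)

  1≤cardD⇒D-pair : 1 ≤ cardD D → ∃ λ ((a , b) : Fin n × Fin n) → T (D a b)
  1≤cardD⇒D-pair 1≤ with ab , ab∈ ← 1≤length⇒∈ 1≤ = ab , ∈-dPairs⁻ ab∈

  exceptional⇒count≡1 : 2 ≤ n → Exceptional G A D → countN A D ≡ 1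
  exceptional⇒count≡1 2≤n (_ , 1≤cardD , v , tp , tc , tw) = trans countN≡length
    (length-unique-⇔ coveringPermutations-unique ([] ∷ []) (mk⇔ (here ∘ ≡x₀) λ { (here refl) → x₀∈ }))
    where
    x₀ = toList v
    ux₀ : Unique x₀
    ux₀ = distinct⇒Unique v tp
    cov₀ : Covering x₀
    cov₀ = covers⇒Covering v tc
    x₀∈ : x₀ ∈ coveringPermutations
    x₀∈ = ∈-coveringPermutations⁺ (length-toList v , ux₀ , cov₀)
    ≡x₀ : ∀ {xs} → xs ∈ coveringPermutations → xs ≡ x₀
    ≡x₀ {xs} xs∈ with len , uxs , cov ← ∈-coveringPermutations⁻ xs∈
      with ⊑⇒≡∨≡reverse x₀ xs (subst (2 ≤_) (sym (length-toList v)) 2≤n) (trans (length-toList v) (sym len))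
                          ux₀ uxs (Covering⇒Adjacent cov ∘ within⇒Chain v tw)
    ... | inj₁ xs≡x₀  = xs≡x₀
    ... | inj₂ xs≡x₀ᴿ with (a , b) , td ← 1≤cardD⇒D-pair 1≤cardD =
      ⊥-elim (consecutive-asym ux₀ (proj₂ cov₀ td)
        (∈-consecutive-reverse⁻ x₀ (subst (λ l → (a , b) ∈ consecutive l) xs≡x₀ᴿ (proj₂ cov td))))

  chain⇒exceptional : ∀ {xs} → IsCoveringPermutation xs → Chain xs → 1 ≤ cardD D → Exceptional G A D
  chain⇒exceptional {xs} perm@(len , uxs , cov) chain 1≤cardD with v , refl ← toList-surjective xs len =
    chain⇒cardA+cardD perm chain , 1≤cardD , v , Unique⇒distinct v uxs , Covering⇒covers v cov , Chain⇒within v chain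

  module _ (no-D : ∀ {a b} → ¬ T (D a b)) where

    Chain-reverse : ∀ {xs} → Chain xs → Chain (reverse xs)
    Chain-reverse {xs} chain {u} {w} uw∈ with to (T-∨ {A w u}) (chain (∈-consecutive-reverse⁻ xs uw∈))
    ... | inj₁ ta = from T-∨ (inj₁ (subst T (A-sym w u) ta))
    ... | inj₂ td = ⊥-elim (no-D td)

    chain-matched : 2 ≤ n → ∀ {xs} → IsCoveringPermutation xs → Chain xs → Matched swapBlocks coveringPermutations xs
    chain-matched 2≤n {xs} (len , uxs , cov) chain rewrite swapBlocks-chain xs chain =
      ∈-coveringPermutations⁺ (trans (length-reverse xs) len , Unique-resp-↭ (↭-sym (↭-reverse xs)) uxs ,
                               (Adjacent-reverse xs ∘ proj₁ cov , ⊥-elim ∘ no-D)) ,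
      trans (swapBlocks-chain (reverse xs) (Chain-reverse chain)) (reverse-involutive xs) ,
      reverse-≢ xs (subst (2 ≤_) (sym len) 2≤n) uxs

  swapped-matched : ∀ {xs} → IsCoveringPermutation xs → Swapped xs → Matched swapBlocks coveringPermutations xs
  swapped-matched (len , uxs , cov) s =
    ∈-coveringPermutations⁺ (trans (↭-length permutation) len , Unique-resp-↭ (↭-sym permutation) uxs ,
                             Covering-transfer keeps-chains cov) ,
    involutive , fixed-point-free
    where open Swapped s

  swapBlocks-pairsUp : 2 ≤ n → ¬ Exceptional G A D → PairsUp swapBlocks coveringPermutations
  swapBlocks-pairsUp 2≤n ¬exceptional xs∈ with perm@(_ , uxs , cov) ← ∈-coveringPermutations⁻ xs∈
    with chain⊎swapped _ uxs (Covering⇒Realizes cov)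
  ... | inj₂ s     = swapped-matched perm s
  ... | inj₁ chain with 1 ≤? cardD D
  ...   | yes 1≤cardD = ⊥-elim (¬exceptional (chain⇒exceptional perm chain 1≤cardD))
  ...   | no ¬1≤cardD = chain-matched (¬1≤cardD ∘ D-pair⇒1≤cardD) 2≤n perm chain

  ¬exceptional⇒2∣count : 2 ≤ n → ¬ Exceptional G A D → 2 ∣ countN A D
  ¬exceptional⇒2∣count 2≤n ¬exceptional =
    subst (2 ∣_) (sym countN≡length) (PairsUp⇒even coveringPermutations-unique (swapBlocks-pairsUp 2≤n ¬exceptional))

lemma1 : (n : ℕ) → 2 ≤ n → (G : MixedGraph n) → (A D : Fin n → Fin n → Bool) →
         ValidA G A → ValidD G D →
         (Exceptional G A D → countN A D ≡ 1) × (¬ Exceptional G A D → 2 ∣ countN A D)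
lemma1 n 2≤n G A D validA validD =
  exceptional⇒count≡1 G validA validD 2≤n , ¬exceptional⇒2∣count G validA validD 2≤n
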